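{- Let $X,Y$ be finite simple graphs and let $X'$ and $Y'$ be induced subgraphs of $X$ and $Y$, respectively. If $X$ is vertex transitive then $$ \alpha(X\ltimes Y)\le\frac{|V(X)|}{|V(X')|}\alpha(X'\ltimes Y). $$ If $Y$ is vertex transitive then $$ \alpha(X\ltimes Y)\le\frac{|V(Y)|}{|V(Y')|}\alpha(X\ltimes Y'). $$
   Context: $\alpha(\cdot)$ is the independence number. The homomorphic product $X\ltimes Y$ is the simple graph on $V(X)\times V(Y)$ in which distinct $(x_1,y_1),(x_2,y_2)$ are adjacent iff $x_1=x_2$, or $x_1\sim x_2$ in $X$ and $y_1,y_2$ are not adjacent in $Y$ (possibly $y_1=y_2$). -}

module Defs where

open import Data.Nat using (ℕ; zero; suc; _*_; _⊔_)
open import Data.Bool using (Bool; true; false; not; _∧_; _∨_; if_then_else_)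
open import Data.Fin using (Fin; remQuot; _≟_)
open import Data.Fin.Subset using (Subset; inside; outside; ∣_∣)
open import Data.Vec using (Vec; []; _∷_; lookup)
open import Data.List using (List; []; _∷_; map; _++_; foldr; allFin)
open import Data.Product using (Σ; _×_; _,_; proj₁; proj₂)
open import Relation.Nullary.Decidable using (isYes)
open import Relation.Binary.PropositionalEquality using (_≡_)
open import Function.Bundles using (_↔_; Inverse)

record Graph : Set where
  field
    n   : ℕ
    adj : Fin n → Fin n → Bool
open Graph public

IsSimple : Graph → Set
IsSimple G = (∀ i j → adj G i j ≡ adj G j i) × (∀ i → adj G i i ≡ false)

induce : (G : Graph) {k : ℕ} → (Fin k → Fin (n G)) → Graph
induce G {k} f = record { n = k ; adj = λ i j → adj G (f i) (f j) }

VertexTransitive : Graph → Set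
VertexTransitive G =
  ∀ u v → Σ (Fin (n G) ↔ Fin (n G)) λ σ →
    (∀ a b → adj G (Inverse.to σ a) (Inverse.to σ b) ≡ adj G a b) × (Inverse.to σ u ≡ v)

-- Homomorphic product X ⋉ Y on V(X) × V(Y), encoded as Fin (n X * n Y) via remQuot.
_⋉_ : Graph → Graph → Graph
X ⋉ Y = record { n = n X * n Y ; adj = A }
  where
  A : Fin (n X * n Y) → Fin (n X * n Y) → Bool
  A u v with remQuot (n Y) u | remQuot (n Y) v
  ... | (x₁ , y₁) | (x₂ , y₂) =
    not (isYes (u ≟ v)) ∧ (isYes (x₁ ≟ x₂) ∨ (adj X x₁ x₂ ∧ not (adj Y y₁ y₂)))

subsets : (m : ℕ) → List (Subset m)
subsets zero    = [] ∷ []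
subsets (suc m) = map (inside ∷_) (subsets m) ++ map (outside ∷_) (subsets m)

allᵇ : {A : Set} → (A → Bool) → List A → Bool
allᵇ p = foldr (λ x b → p x ∧ b) true

independent? : (G : Graph) → Subset (n G) → Bool
independent? G S =
  allᵇ (λ i → allᵇ (λ j → not (lookup S i ∧ lookup S j ∧ adj G i j)) (allFin (n G))) (allFin (n G))

α : Graph → ℕ
α G = foldr _⊔_ 0 (map (λ S → if independent? G S then ∣ S ∣ else 0) (subsets (n G)))

-- Let S be a maximum independent set of X ⋉ Y and w x = |S ∩ ({x} × V(Y))|. For an automorphism
-- h of X, (x′ , y) ↦ (h x′ , y) embeds X′ ⋉ Y into X ⋉ Y as an induced subgraph, so
-- Σ_{x′ ∈ V(X′)} w (h x′) ≤ α (X′ ⋉ Y). Sum this over Aut(X): by vertex transitivity the orbit sum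
-- C u = Σ_h w (h u) does not depend on u, while Σ_u C u = |Aut(X)| · α (X ⋉ Y); hence
-- |V(X′)| · |Aut(X)| · α (X ⋉ Y) / |V(X)| ≤ |Aut(X)| · α (X′ ⋉ Y).
-- The second inequality is the same argument on the rows V(X) × {y}, averaged over Aut(Y).
module Submission where

open import Defs
import Data.Nat.Properties as ℕ
open import Algebra.Properties.CommutativeSemigroup ℕ.*-commutativeSemigroup using (x∙yz≈y∙xz)
open import Algebra.Properties.Semiring.Sum ℕ.+-*-semiring
  using (sum; sum-syntax; ∑-comm; ∑-permute; sum-cong-≗; *-distribˡ-sum; *-distribʳ-sum)
open import Data.Bool using (Bool; true; false; not; _∧_; _∨_; if_then_else_)
import Data.Bool.Properties as Bool
open import Data.Empty using (⊥-elim)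
open import Data.Fin using (Fin; zero; suc; combine; remQuot; _↑ˡ_; _↑ʳ_; _≟_; finToFun; funToFin)
open import Data.Fin.Permutation using (Permutation; permutation; _⟨$⟩ʳ_)
open import Data.Fin.Properties
  using (remQuot-combine; combine-remQuot; combine-injective; finToFun-funToFin; funToFin-finToFin; all?; any?)
open import Data.Fin.Subset using (Subset; ∣_∣)
open import Data.List using ([]; _∷_; allFin)
open import Data.List.Membership.Propositional using (_∈_)
open import Data.List.Membership.Propositional.Properties using (∈-map⁺; ∈-++⁺ˡ; ∈-++⁺ʳ; ∈-allFin)
open import Data.List.Properties using (foldr-preservesᵒ; foldr-preservesᵇ)
import Data.List.Relation.Unary.All as All
import Data.List.Relation.Unary.All.Properties as All
open import Data.List.Relation.Unary.Any as Any using (here; there)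
open import Data.Nat using (ℕ; zero; suc; _+_; _*_; _^_; _≤_; _⊔_; z≤n; NonZero; >-nonZero)
open import Data.Nat.Properties
  using ( +-assoc; ≤-reflexive; ≤-trans; m≤m+n; m≤n+m; +-mono-≤
        ; *-monoʳ-≤; *-cancelˡ-≤; ⊔-sel; m≤n⇒m≤n⊔o; m≤n⇒m≤o⊔n; module ≤-Reasoning)
open import Data.Product using (∃; _×_; _,_; proj₁; proj₂; uncurry)
import Data.Product as Product
open import Data.Product.Properties using (×-≡,≡→≡)
open import Data.Sum using (inj₁; inj₂; [_,_])
open import Data.Vec using ([]; _∷_; lookup; tabulate)
open import Data.Vec.Properties using (lookup∘tabulate)
open import Function using (_∘_; id; _⇔_; mk⇔; Inverse; _↔_)
open import Function.Definitions using (Injective)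
open import Relation.Binary.PropositionalEquality
  using (_≡_; _≗_; refl; sym; trans; cong; cong₂; subst; module ≡-Reasoning)
open import Relation.Nullary using (Dec; yes; no; _×-dec_; _→-dec_)
open import Relation.Nullary.Decidable using (isYes; isYes≗does; does-⇔; map′)

sum-const : ∀ m c → ∑[ _ < m ] c ≡ m * c
sum-const zero    c = refl
sum-const (suc m) c = cong (c +_) (sum-const m c)

sum-mono-≤ : ∀ {m} {f g : Fin m → ℕ} → (∀ i → f i ≤ g i) → sum f ≤ sum g
sum-mono-≤ {zero}  _   = z≤n
sum-mono-≤ {suc m} f≤g = +-mono-≤ (f≤g zero) (sum-mono-≤ (f≤g ∘ suc))

≤-sum : ∀ {m} (f : Fin m → ℕ) i → f i ≤ sum f
≤-sum f zero    = m≤m+n (f zero) _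
≤-sum f (suc i) = ≤-trans (≤-sum (f ∘ suc) i) (m≤n+m _ (f zero))

sum-↑ : ∀ a b (F : Fin (a + b) → ℕ) → sum F ≡ ∑[ i < a ] F (i ↑ˡ b) + ∑[ j < b ] F (a ↑ʳ j)
sum-↑ zero    b F = refl
sum-↑ (suc a) b F = trans (cong (F zero +_) (sum-↑ a b (F ∘ suc))) (sym (+-assoc (F zero) _ _))

sum-combine : ∀ a b (F : Fin (a * b) → ℕ) → sum F ≡ ∑[ x < a ] ∑[ y < b ] F (combine x y)
sum-combine zero    b F = refl
sum-combine (suc a) b F =
  trans (sum-↑ b (a * b) F) (cong (∑[ y < b ] F (y ↑ˡ (a * b)) +_) (sum-combine a b (F ∘ (b ↑ʳ_))))

-- Summing over a dummy index avoids choosing a point of Fin m, which may be empty.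
sum-∘-constant : ∀ {m k} (C : Fin m → ℕ) (f : Fin k → Fin m) →
  (∀ u v → C u ≡ C v) → m * sum (C ∘ f) ≡ k * sum C
sum-∘-constant {m} {k} C f C-const = begin
  m * sum (C ∘ f)            ≡⟨ sum-const m _ ⟨
  ∑[ v < m ] sum (C ∘ f)     ≡⟨ sum-cong-≗ (λ v → sum-cong-≗ (λ u → C-const (f u) v)) ⟩
  ∑[ v < m ] ∑[ _ < k ] C v  ≡⟨ sum-cong-≗ (λ v → sum-const k (C v)) ⟩
  ∑[ v < m ] (k * C v)       ≡⟨ *-distribˡ-sum k C ⟨
  k * sum C                  ∎
  where open ≡-Reasoning

⌜_⌝ : Bool → ℕ
⌜ b ⌝ = if b then 1 else 0

size : ∀ {m} → (Fin m → Bool) → ℕ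
size P = sum (⌜_⌝ ∘ P)

∣∣≡size : ∀ {m} (S : Subset m) → ∣ S ∣ ≡ size (lookup S)
∣∣≡size []          = refl
∣∣≡size (true ∷ S)  = cong suc (∣∣≡size S)
∣∣≡size (false ∷ S) = ∣∣≡size S

isYes-⇔ : ∀ {A B : Set} → A ⇔ B → (a? : Dec A) (b? : Dec B) → isYes a? ≡ isYes b?
isYes-⇔ A⇔B a? b? = trans (isYes≗does a?) (trans (does-⇔ A⇔B a? b?) (sym (isYes≗does b?)))

Independent : (G : Graph) → (Fin (n G) → Bool) → Set
Independent G P = ∀ i j → P i ≡ true → P j ≡ true → adj G i j ≡ false

allᵇ-true : ∀ {A : Set} (p : A → Bool) xs → (∀ x → p x ≡ true) → allᵇ p xs ≡ true
allᵇ-true p []       _  = refl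
allᵇ-true p (x ∷ xs) px rewrite px x = allᵇ-true p xs px

allᵇ-true⁻ : ∀ {A : Set} (p : A → Bool) xs → allᵇ p xs ≡ true → ∀ {x} → x ∈ xs → p x ≡ true
allᵇ-true⁻ p (y ∷ xs) all-p (here refl) with p y | all-p
... | true | _ = refl
allᵇ-true⁻ p (y ∷ xs) all-p (there x∈xs) with p y | all-p
... | true | all-p-xs = allᵇ-true⁻ p xs all-p-xs x∈xs

independent?-complete : (G : Graph) (S : Subset (n G)) → Independent G (lookup S) → independent? G S ≡ true
independent?-complete G S S-indep =
  allᵇ-true _ (allFin (n G)) λ i → allᵇ-true _ (allFin (n G)) λ j → nonadjacent i j
  where
  nonadjacent : ∀ i j → not (lookup S i ∧ lookup S j ∧ adj G i j) ≡ true
  nonadjacent i j with lookup S i in i∈S | lookup S j in j∈S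
  ... | false | _     = refl
  ... | true  | false = refl
  ... | true  | true  rewrite S-indep i j i∈S j∈S = refl

independent?-sound : (G : Graph) (S : Subset (n G)) → independent? G S ≡ true → Independent G (lookup S)
independent?-sound G S S-indep i j i∈S j∈S
  with allᵇ-true⁻ _ _ (allᵇ-true⁻ _ _ S-indep (∈-allFin i)) (∈-allFin j)
... | nonadjacent rewrite i∈S | j∈S = Bool.not-injective nonadjacent

∈-subsets : ∀ {m} (S : Subset m) → S ∈ subsets m
∈-subsets []          = here refl
∈-subsets (true ∷ S)  = ∈-++⁺ˡ (∈-map⁺ _ (∈-subsets S))
∈-subsets (false ∷ S) = ∈-++⁺ʳ _ (∈-map⁺ _ (∈-subsets S))

module _ (G : Graph) where

  private
    value : Subset (n G) → ℕ
    value S = if independent? G S then ∣ S ∣ else 0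

  size≤α : ∀ P → Independent G P → size P ≤ α G
  size≤α P P-indep =
    foldr-preservesᵒ (λ x y → [ m≤n⇒m≤n⊔o y , m≤n⇒m≤o⊔n x ]) 0 _
      (inj₂ (Any.map (λ eq → subst (size P ≤_) eq size≤value) (∈-map⁺ value (∈-subsets S))))
    where
    S : Subset (n G)
    S = tabulate P

    S-indep : Independent G (lookup S)
    S-indep i j i∈S j∈S =
      P-indep i j (trans (sym (lookup∘tabulate P i)) i∈S) (trans (sym (lookup∘tabulate P j)) j∈S)

    size≤value : size P ≤ value S
    size≤value rewrite independent?-complete G S S-indep =
      ≤-reflexive (trans (sum-cong-≗ (cong ⌜_⌝ ∘ sym ∘ lookup∘tabulate P)) (sym (∣∣≡size S)))

  HasIndependent≥ : ℕ → Set
  HasIndependent≥ a = ∃ λ P → Independent G P × a ≤ size P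

  α-attained : HasIndependent≥ (α G)
  α-attained =
    foldr-preservesᵇ {P = HasIndependent≥} HasIndependent≥-⊔ ((λ _ → false) , (λ _ _ ()) , z≤n)
      (All.map⁺ (All.universal HasIndependent≥-value (subsets (n G))))
    where
    HasIndependent≥-⊔ : ∀ {a b} → HasIndependent≥ a → HasIndependent≥ b → HasIndependent≥ (a ⊔ b)
    HasIndependent≥-⊔ {a} {b} at-a at-b with ⊔-sel a b
    ... | inj₁ a⊔b≡a rewrite a⊔b≡a = at-a
    ... | inj₂ a⊔b≡b rewrite a⊔b≡b = at-b

    HasIndependent≥-value : ∀ S → HasIndependent≥ (value S)
    HasIndependent≥-value S with independent? G S in S-indep
    ... | true  = lookup S , independent?-sound G S S-indep , ≤-reflexive (∣∣≡size S)
    ... | false = (λ _ → false) , (λ _ _ ()) , z≤n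

record Embedding (H G : Graph) : Set where
  field
    to            : Fin (n H) → Fin (n G)
    injective     : Injective _≡_ _≡_ to
    preserves-adj : ∀ a b → adj G (to a) (to b) ≡ adj H a b

open Embedding

id-embedding : ∀ {G} → Embedding G G
id-embedding = record { to = id ; injective = id ; preserves-adj = λ _ _ → refl }

_∘-embedding_ : ∀ {G H K} → Embedding H G → Embedding K H → Embedding K G
φ ∘-embedding ψ = record
  { to            = to φ ∘ to ψ
  ; injective     = injective ψ ∘ injective φ
  ; preserves-adj = λ a b → trans (preserves-adj φ (to ψ a) (to ψ b)) (preserves-adj ψ a b)
  }

induce-embedding : ∀ (G : Graph) {k} {f : Fin k → Fin (n G)} → Injective _≡_ _≡_ f → Embedding (induce G f) G
induce-embedding G {f = f} f-inj = record { to = f ; injective = f-inj ; preserves-adj = λ _ _ → refl }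

Independent-pullback : ∀ {H G} (φ : Embedding H G) {P} → Independent G P → Independent H (P ∘ to φ)
Independent-pullback φ P-indep a b a∈P b∈P = trans (sym (preserves-adj φ a b)) (P-indep _ _ a∈P b∈P)

isYes-≟-injective : ∀ {k m} {f : Fin k → Fin m} → Injective _≡_ _≡_ f →
  ∀ a b → isYes (f a ≟ f b) ≡ isYes (a ≟ b)
isYes-≟-injective {f = f} f-inj a b = isYes-⇔ (mk⇔ f-inj (cong f)) (f a ≟ f b) (a ≟ b)

⋉-adjacency : (X Y : Graph) → Bool → Fin (n X) × Fin (n Y) → Fin (n X) × Fin (n Y) → Bool
⋉-adjacency X Y equal (x₁ , y₁) (x₂ , y₂) = not equal ∧ (isYes (x₁ ≟ x₂) ∨ (adj X x₁ x₂ ∧ not (adj Y y₁ y₂)))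

⋉-adj : (X Y : Graph) (u v : Fin (n (X ⋉ Y))) →
  adj (X ⋉ Y) u v ≡ ⋉-adjacency X Y (isYes (u ≟ v)) (remQuot (n Y) u) (remQuot (n Y) v)
⋉-adj X Y u v = refl

module _ {X′ X Y′ Y : Graph} (φ : Embedding X′ X) (ψ : Embedding Y′ Y) where

  private
    φ×ψ : Fin (n X′) × Fin (n Y′) → Fin (n X) × Fin (n Y)
    φ×ψ = Product.map (to φ) (to ψ)

    ⋉-to : Fin (n (X′ ⋉ Y′)) → Fin (n (X ⋉ Y))
    ⋉-to = uncurry combine ∘ φ×ψ ∘ remQuot (n Y′)

    remQuot-⋉-to : ∀ u → remQuot (n Y) (⋉-to u) ≡ φ×ψ (remQuot (n Y′) u)
    remQuot-⋉-to u = remQuot-combine (to φ _) (to ψ _)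

    ⋉-to-injective : Injective _≡_ _≡_ ⋉-to
    ⋉-to-injective {u} {v} eq = begin
      u                                          ≡⟨ combine-remQuot {n X′} (n Y′) u ⟨
      uncurry combine (remQuot {n X′} (n Y′) u)  ≡⟨ cong (uncurry combine) (×-≡,≡→≡ (injective φ x≡ , injective ψ y≡)) ⟩
      uncurry combine (remQuot {n X′} (n Y′) v)  ≡⟨ combine-remQuot {n X′} (n Y′) v ⟩
      v                                          ∎
      where
      open ≡-Reasoning
      x≡ : to φ (proj₁ (remQuot (n Y′) u)) ≡ to φ (proj₁ (remQuot (n Y′) v))
      x≡ = proj₁ (combine-injective (to φ _) (to ψ _) (to φ _) (to ψ _) eq)
      y≡ : to ψ (proj₂ (remQuot {n X′} (n Y′) u)) ≡ to ψ (proj₂ (remQuot {n X′} (n Y′) v))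
      y≡ = proj₂ (combine-injective (to φ _) (to ψ _) (to φ _) (to ψ _) eq)

    ⋉-adjacency-φ×ψ : ∀ d p q → ⋉-adjacency X Y d (φ×ψ p) (φ×ψ q) ≡ ⋉-adjacency X′ Y′ d p q
    ⋉-adjacency-φ×ψ d (x₁ , y₁) (x₂ , y₂) = cong₂ (λ e a → not d ∧ (e ∨ a))
      (isYes-≟-injective (injective φ) x₁ x₂)
      (cong₂ (λ a b → a ∧ not b) (preserves-adj φ x₁ x₂) (preserves-adj ψ y₁ y₂))

  _⋉-embedding_ : Embedding (X′ ⋉ Y′) (X ⋉ Y)
  _⋉-embedding_ = record
    { to            = ⋉-to
    ; injective     = ⋉-to-injective
    ; preserves-adj = λ u v → begin
        adj (X ⋉ Y) (⋉-to u) (⋉-to v)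
          ≡⟨ ⋉-adj X Y (⋉-to u) (⋉-to v) ⟩
        ⋉-adjacency X Y (isYes (⋉-to u ≟ ⋉-to v)) (remQuot (n Y) (⋉-to u)) (remQuot (n Y) (⋉-to v))
          ≡⟨ cong₂ (⋉-adjacency X Y (isYes (⋉-to u ≟ ⋉-to v))) (remQuot-⋉-to u) (remQuot-⋉-to v) ⟩
        ⋉-adjacency X Y (isYes (⋉-to u ≟ ⋉-to v)) (φ×ψ (remQuot _ u)) (φ×ψ (remQuot _ v))
          ≡⟨ cong (λ d → ⋉-adjacency X Y d _ _) (isYes-≟-injective ⋉-to-injective u v) ⟩
        ⋉-adjacency X Y (isYes (u ≟ v)) (φ×ψ (remQuot _ u)) (φ×ψ (remQuot _ v))
          ≡⟨ ⋉-adjacency-φ×ψ _ _ _ ⟩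
        ⋉-adjacency X′ Y′ (isYes (u ≟ v)) (remQuot (n Y′) u) (remQuot (n Y′) v)
          ≡⟨ ⋉-adj X′ Y′ u v ⟨
        adj (X′ ⋉ Y′) u v
          ∎
    }
    where open ≡-Reasoning

  ⋉-embedding-combine : ∀ x y → to _⋉-embedding_ (combine x y) ≡ combine (to φ x) (to ψ y)
  ⋉-embedding-combine x y = cong (uncurry combine ∘ φ×ψ) (remQuot-combine x y)

record IsAutomorphism (G : Graph) (h : Fin (n G) → Fin (n G)) : Set where
  constructor isAutomorphism
  field
    preserves-adj : ∀ a b → adj G (h a) (h b) ≡ adj G a b
    injective     : ∀ a b → h a ≡ h b → a ≡ b
    surjective    : ∀ b → ∃ λ a → h a ≡ b

module _ {G : Graph} where

  isAutomorphism? : ∀ h → Dec (IsAutomorphism G h)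
  isAutomorphism? h = map′ (λ (p , i , s) → isAutomorphism p i s) (λ (isAutomorphism p i s) → p , i , s)
    (all? (λ a → all? (λ b → adj G (h a) (h b) Bool.≟ adj G a b))
      ×-dec all? (λ a → all? (λ b → (h a ≟ h b) →-dec (a ≟ b)))
      ×-dec all? (λ b → any? (λ a → h a ≟ b)))

  IsAutomorphism-resp-≗ : ∀ {h h′} → h ≗ h′ → IsAutomorphism G h → IsAutomorphism G h′
  IsAutomorphism-resp-≗ {h} {h′} h≗h′ (isAutomorphism p i s) = isAutomorphism
    (λ a b → trans (cong₂ (adj G) (sym (h≗h′ a)) (sym (h≗h′ b))) (p a b))
    (λ a b eq → i a b (trans (h≗h′ a) (trans eq (sym (h≗h′ b)))))
    (λ b → proj₁ (s b) , trans (sym (h≗h′ _)) (proj₂ (s b)))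

  IsAutomorphism-id : IsAutomorphism G id
  IsAutomorphism-id = isAutomorphism (λ _ _ → refl) (λ _ _ → id) (λ b → b , refl)

  IsAutomorphism-∘ : ∀ {h t} → IsAutomorphism G h → IsAutomorphism G t → IsAutomorphism G (h ∘ t)
  IsAutomorphism-∘ {h} {t} (isAutomorphism pₕ iₕ sₕ) (isAutomorphism pₜ iₜ sₜ) = isAutomorphism
    (λ a b → trans (pₕ (t a) (t b)) (pₜ a b))
    (λ a b eq → iₜ a b (iₕ (t a) (t b) eq))
    (λ b → let (a , ha≡b) = sₕ b ; (a′ , ta′≡a) = sₜ a in a′ , trans (cong h ta′≡a) ha≡b)

  ↔-IsAutomorphism : (τ : Fin (n G) ↔ Fin (n G)) → (∀ a b → adj G (Inverse.to τ a) (Inverse.to τ b) ≡ adj G a b) →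
    IsAutomorphism G (Inverse.to τ) × IsAutomorphism G (Inverse.from τ)
  ↔-IsAutomorphism τ pres =
    isAutomorphism pres
      (λ a b eq → trans (sym (from∘to a)) (trans (cong τ.from eq) (from∘to b)))
      (λ b → τ.from b , to∘from b) ,
    isAutomorphism
      (λ a b → trans (sym (pres (τ.from a) (τ.from b))) (cong₂ (adj G) (to∘from a) (to∘from b)))
      (λ a b eq → trans (sym (to∘from a)) (trans (cong τ.to eq) (to∘from b)))
      (λ b → τ.to b , from∘to b)
    where
    module τ = Inverse τ
    to∘from : ∀ b → τ.to (τ.from b) ≡ b
    to∘from = τ.strictlyInverseˡ
    from∘to : ∀ a → τ.from (τ.to a) ≡ a
    from∘to = τ.strictlyInverseʳ

  IsAutomorphism⇒Permutation : ∀ {h} → IsAutomorphism G h → Permutation (n G) (n G)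
  IsAutomorphism⇒Permutation {h} (isAutomorphism _ i s) =
    permutation h (proj₁ ∘ s) (proj₂ ∘ s) (λ a → i _ _ (proj₂ (s (h a))))

  IsAutomorphism⇒Embedding : ∀ {h} → IsAutomorphism G h → Embedding G G
  IsAutomorphism⇒Embedding {h} (isAutomorphism p i _) = record { to = h ; injective = i _ _ ; preserves-adj = p }

funToFin-cong : ∀ {a b} {f g : Fin a → Fin b} → f ≗ g → funToFin f ≡ funToFin g
funToFin-cong {zero}  _   = refl
funToFin-cong {suc a} f≗g = cong₂ combine (f≗g zero) (funToFin-cong (f≗g ∘ suc))

module _ {a m : ℕ} (τ : Fin a ↔ Fin a) where

  private
    module τ = Inverse τ

  precompose : Permutation (m ^ a) (m ^ a)
  precompose = permutation (λ i → funToFin (finToFun i ∘ τ.to)) (λ i → funToFin (finToFun i ∘ τ.from))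
    (λ i → trans (funToFin-cong λ x → trans (finToFun-funToFin _ (τ.to x)) (cong (finToFun i) (τ.strictlyInverseʳ x)))
                 (funToFin-finToFin {a} {m} i))
    (λ i → trans (funToFin-cong λ x → trans (finToFun-funToFin _ (τ.from x)) (cong (finToFun i) (τ.strictlyInverseˡ x)))
                 (funToFin-finToFin {a} {m} i))

  finToFun-precompose : ∀ i → finToFun (precompose ⟨$⟩ʳ i) ≗ finToFun i ∘ τ.to
  finToFun-precompose i = finToFun-funToFin _

-- Aut(Z) is summed over as the maps Fin m → Fin m, coded by Fin (m ^ m), weighted by whether they are automorphisms.
module AutomorphismSum (Z : Graph) where

  private
    m = n Z

  isAut : Fin (m ^ m) → Bool
  isAut i = isYes (isAutomorphism? {Z} (finToFun i))

  isAut-sound : ∀ i → isAut i ≡ true → IsAutomorphism Z (finToFun i)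
  isAut-sound i eq with isAutomorphism? {Z} (finToFun i) | eq
  ... | yes aut | _ = aut

  isAut-complete : ∀ i → IsAutomorphism Z (finToFun i) → isAut i ≡ true
  isAut-complete i aut with isAutomorphism? {Z} (finToFun i)
  ... | yes _    = refl
  ... | no ¬aut  = ⊥-elim (¬aut aut)

  ∑Aut : ((Fin m → Fin m) → ℕ) → ℕ
  ∑Aut F = ∑[ i < m ^ m ] (⌜ isAut i ⌝ * F (finToFun i))

  #Aut : ℕ
  #Aut = ∑[ i < m ^ m ] ⌜ isAut i ⌝

  1≤#Aut : 1 ≤ #Aut
  1≤#Aut = subst (λ b → ⌜ b ⌝ ≤ #Aut) (isAut-complete id-code id-isAut) (≤-sum (⌜_⌝ ∘ isAut) id-code)
    where
    id-code : Fin (m ^ m)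
    id-code = funToFin {m} {m} id
    id-isAut : IsAutomorphism Z (finToFun id-code)
    id-isAut = IsAutomorphism-resp-≗ (sym ∘ finToFun-funToFin id) IsAutomorphism-id

  ∑Aut-const : ∀ c → ∑Aut (λ _ → c) ≡ #Aut * c
  ∑Aut-const c = sym (*-distribʳ-sum c (⌜_⌝ ∘ isAut))

  ∑Aut-mono-≤ : ∀ {F F′} → (∀ h → IsAutomorphism Z h → F h ≤ F′ h) → ∑Aut F ≤ ∑Aut F′
  ∑Aut-mono-≤ {F} {F′} F≤F′ = sum-mono-≤ term≤
    where
    term≤ : ∀ i → ⌜ isAut i ⌝ * F (finToFun i) ≤ ⌜ isAut i ⌝ * F′ (finToFun i)
    term≤ i with isAut i in aut
    ... | true  = *-monoʳ-≤ 1 (F≤F′ _ (isAut-sound i aut))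
    ... | false = z≤n

  ∑Aut-sum-comm : ∀ {k} (F : (Fin m → Fin m) → Fin k → ℕ) →
    ∑[ u < k ] ∑Aut (λ h → F h u) ≡ ∑Aut (sum ∘ F)
  ∑Aut-sum-comm F = trans (∑-comm (λ u i → ⌜ isAut i ⌝ * F (finToFun i) u))
    (sum-cong-≗ λ i → sym (*-distribˡ-sum ⌜ isAut i ⌝ (F (finToFun i))))

  ∑Aut-precompose : (τ : Fin m ↔ Fin m) → (∀ a b → adj Z (Inverse.to τ a) (Inverse.to τ b) ≡ adj Z a b) →
    (w : Fin m → ℕ) → ∀ v → ∑Aut (λ h → w (h v)) ≡ ∑Aut (λ h → w (h (Inverse.to τ v)))
  ∑Aut-precompose τ pres w v = trans (∑-permute _ (precompose τ))
    (sum-cong-≗ λ i → cong₂ (λ b x → ⌜ b ⌝ * w x) (isAut-precompose i) (finToFun-precompose τ i v))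
    where
    module τ = Inverse τ
    τ-aut : IsAutomorphism Z τ.to × IsAutomorphism Z τ.from
    τ-aut = ↔-IsAutomorphism τ pres

    isAut-precompose : ∀ i → isAut (precompose τ ⟨$⟩ʳ i) ≡ isAut i
    isAut-precompose i = isYes-⇔ (mk⇔
      (λ aut → IsAutomorphism-resp-≗
        (λ x → trans (finToFun-precompose τ i (τ.from x)) (cong (finToFun i) (τ.strictlyInverseˡ x)))
        (IsAutomorphism-∘ aut (proj₂ τ-aut)))
      (λ aut → IsAutomorphism-resp-≗ (sym ∘ finToFun-precompose τ i) (IsAutomorphism-∘ aut (proj₁ τ-aut))))
      (isAutomorphism? {Z} _) (isAutomorphism? {Z} _)

  ∑Aut-orbit-constant : VertexTransitive Z → (w : Fin m → ℕ) →
    ∀ u v → ∑Aut (λ h → w (h u)) ≡ ∑Aut (λ h → w (h v))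
  ∑Aut-orbit-constant vt w u v with vt v u
  ... | τ , pres , τv≡u = trans (cong (λ x → ∑Aut (λ h → w (h x))) (sym τv≡u)) (sym (∑Aut-precompose τ pres w v))

  vertex-transitive-averaging : VertexTransitive Z → ∀ {k} (f : Fin k → Fin m) (w : Fin m → ℕ) (β : ℕ) →
    (∀ h → IsAutomorphism Z h → sum (w ∘ h ∘ f) ≤ β) → k * sum w ≤ m * β
  vertex-transitive-averaging vt {k} f w β bound = *-cancelˡ-≤ #Aut (begin
    #Aut * (k * sum w)                   ≡⟨ x∙yz≈y∙xz #Aut k (sum w) ⟩
    k * (#Aut * sum w)                   ≡⟨ cong (k *_) (∑Aut-const (sum w)) ⟨
    k * ∑Aut (λ _ → sum w)               ≤⟨ *-monoʳ-≤ k (∑Aut-mono-≤ sum-w≤sum-w∘h) ⟩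
    k * ∑Aut (λ h → sum (w ∘ h))         ≡⟨ cong (k *_) (∑Aut-sum-comm (λ h → w ∘ h)) ⟨
    k * sum C                            ≡⟨ sum-∘-constant C f (∑Aut-orbit-constant vt w) ⟨
    m * sum (C ∘ f)                      ≡⟨ cong (m *_) (∑Aut-sum-comm (λ h → w ∘ h ∘ f)) ⟩
    m * ∑Aut (λ h → sum (w ∘ h ∘ f))     ≤⟨ *-monoʳ-≤ m (∑Aut-mono-≤ bound) ⟩
    m * ∑Aut (λ _ → β)                   ≡⟨ cong (m *_) (∑Aut-const β) ⟩
    m * (#Aut * β)                       ≡⟨ x∙yz≈y∙xz m #Aut β ⟩
    #Aut * (m * β)                       ∎)
    where
    open ≤-Reasoning
    C : Fin m → ℕ
    C u = ∑Aut (λ h → w (h u))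
    sum-w≤sum-w∘h : ∀ h → IsAutomorphism Z h → sum w ≤ sum (w ∘ h)
    sum-w≤sum-w∘h h aut = ≤-reflexive (∑-permute w (IsAutomorphism⇒Permutation aut))
    instance
      #Aut-nonZero : NonZero #Aut
      #Aut-nonZero = >-nonZero 1≤#Aut

⋉-pullback-size≤α : ∀ {X′ X Y′ Y} (φ : Embedding X′ X) (ψ : Embedding Y′ Y) {P} → Independent (X ⋉ Y) P →
  ∑[ x < n X′ ] ∑[ y < n Y′ ] ⌜ P (combine (to φ x) (to ψ y)) ⌝ ≤ α (X′ ⋉ Y′)
⋉-pullback-size≤α {X′} {X} {Y′} {Y} φ ψ {P} P-indep = begin
  ∑[ x < n X′ ] ∑[ y < n Y′ ] ⌜ P (combine (to φ x) (to ψ y)) ⌝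
    ≡⟨ sum-cong-≗ (λ x → sum-cong-≗ (λ y → cong (⌜_⌝ ∘ P) (⋉-embedding-combine φ ψ x y))) ⟨
  ∑[ x < n X′ ] ∑[ y < n Y′ ] ⌜ P (to (φ ⋉-embedding ψ) (combine x y)) ⌝
    ≡⟨ sum-combine (n X′) (n Y′) _ ⟨
  size (P ∘ to (φ ⋉-embedding ψ))
    ≤⟨ size≤α (X′ ⋉ Y′) _ (Independent-pullback (φ ⋉-embedding ψ) P-indep) ⟩
  α (X′ ⋉ Y′)
    ∎
  where open ≤-Reasoning

⋉-induced-left-bound : (X Y : Graph) → VertexTransitive X →
  ∀ {k} (f : Fin k → Fin (n X)) → Injective _≡_ _≡_ f → k * α (X ⋉ Y) ≤ n X * α (induce X f ⋉ Y)
⋉-induced-left-bound X Y vt {k} f f-inj with α-attained (X ⋉ Y)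
... | P , P-indep , α≤|P| =
  ≤-trans (*-monoʳ-≤ k α≤∑w) (AutomorphismSum.vertex-transitive-averaging X vt f w _ column-bound)
  where
  w : Fin (n X) → ℕ
  w x = ∑[ y < n Y ] ⌜ P (combine x y) ⌝

  α≤∑w : α (X ⋉ Y) ≤ sum w
  α≤∑w = ≤-trans α≤|P| (≤-reflexive (sum-combine (n X) (n Y) _))

  column-bound : ∀ h → IsAutomorphism X h → sum (w ∘ h ∘ f) ≤ α (induce X f ⋉ Y)
  column-bound h aut =
    ⋉-pullback-size≤α (IsAutomorphism⇒Embedding aut ∘-embedding induce-embedding X f-inj) (id-embedding {Y}) P-indep

⋉-induced-right-bound : (X Y : Graph) → VertexTransitive Y →
  ∀ {k} (g : Fin k → Fin (n Y)) → Injective _≡_ _≡_ g → k * α (X ⋉ Y) ≤ n Y * α (X ⋉ induce Y g)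
⋉-induced-right-bound X Y vt {k} g g-inj with α-attained (X ⋉ Y)
... | P , P-indep , α≤|P| =
  ≤-trans (*-monoʳ-≤ k α≤∑w) (AutomorphismSum.vertex-transitive-averaging Y vt g w _ row-bound)
  where
  w : Fin (n Y) → ℕ
  w y = ∑[ x < n X ] ⌜ P (combine x y) ⌝

  α≤∑w : α (X ⋉ Y) ≤ sum w
  α≤∑w = ≤-trans α≤|P| (≤-reflexive (trans (sum-combine (n X) (n Y) _) (∑-comm {n X} {n Y} _)))

  row-bound : ∀ h → IsAutomorphism Y h → sum (w ∘ h ∘ g) ≤ α (X ⋉ induce Y g)
  row-bound h aut = ≤-trans
    (≤-reflexive (∑-comm {k} {n X} (λ y x → ⌜ P (combine x (h (g y))) ⌝)))
    (⋉-pullback-size≤α (id-embedding {X}) (IsAutomorphism⇒Embedding aut ∘-embedding induce-embedding Y g-inj) P-indep)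

corollary3 : (X Y : Graph) → IsSimple X → IsSimple Y →
    ((k : ℕ) (f : Fin k → Fin (n X)) → Injective _≡_ _≡_ f → VertexTransitive X →
      k * α (X ⋉ Y) ≤ n X * α (induce X f ⋉ Y))
    ×
    ((k : ℕ) (g : Fin k → Fin (n Y)) → Injective _≡_ _≡_ g → VertexTransitive Y →
      k * α (X ⋉ Y) ≤ n Y * α (X ⋉ induce Y g))
corollary3 X Y _ _ =
  (λ _ f f-inj vt → ⋉-induced-left-bound X Y vt f f-inj) ,
  (λ _ g g-inj vt → ⋉-induced-right-bound X Y vt g g-inj)
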